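{- Let $A,B,C$ be negative arenas, $q$ an augmentation on $A\vdash B$, $p$ an augmentation on $B\vdash C$, and $\varphi:x^q_B\cong_Bx^p_B$ a symmetry. Then the relation $\rhd$ on $|q|+|p|$ is acyclic, i.e. its transitive closure is a strict partial order, so that the interaction $p\circledast_\varphi q$ is a partially ordered set.
   Context: $X+Y=(\{1\}\times X)\cup(\{2\}\times Y)$. A forest is a poset whose principal down-sets are finite and totally ordered; $\lessdot$ is immediate precedence. An arena is a countable forest $(|A|,\le_A)$ with polarity $\mathrm{pol}_A$ alternating along $\lessdot$; negative if its minimal events are negative. $A\otimes B$: events $|A|+|B|$, componentwise order, inherited polarity; $A^\perp$ reverses polarity; $A\vdash B=A^\perp\otimes B$. A configuration on $A$ is a finite forest $(|x|,\le_x)$ with $\partial_x:|x|\to|A|$, $e$ minimal iff $\partial_xe$ minimal, and $e_1\lessdot_xe_2\Rightarrow\partial_xe_1\lessdot_A\partial_xe_2$. A symmetry $\varphi:x\cong_Ay$ is an order-isomorphism with $\partial_y\circ\varphi=\partial_x$. An augmentation $q$ on $A$ is $(|q|,\le_{\langle q\rangle},\le_q,\partial_q)$ with $(|q|,\le_{\langle q\rangle},\partial_q)$ a configuration and $(|q|,\le_q)$ a forest with (polarity of $e$ being $\mathrm{pol}_A(\partial_qe)$): $\le_{\langle q\rangle}\subseteq\le_q$; if $e_1\lessdot_qe_2$ and ($e_1$ positive or $e_2$ negative) then $e_1\lessdot_{\langle q\rangle}e_2$; a negative event has at most one positive immediate $\le_q$-successor; $\le_q$-maximal events positive; $\le_q$-minimal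 events negative. For $q$ on $A\vdash B$, $x^q_B$ is the configuration on $B$ formed by the events $m$ of $q$ with $\partial_q(m)\in\{2\}\times|B|$, ordered by $\le_{\langle q\rangle}$, with display $m\mapsto b$ when $\partial_q(m)=(2,b)$; for $p$ on $B\vdash C$, $x^p_B$ is formed likewise from events displayed into $\{1\}\times|B|$. Given $\varphi:x^q_B\cong_Bx^p_B$, define on $|q|+|p|$ the relation $\rhd=\rhd_q\cup\rhd_p\cup\rhd_\varphi$ with $\rhd_q=\{((1,m),(1,m'))\mid m<_qm'\}$, $\rhd_p=\{((2,m),(2,m'))\mid m<_pm'\}$, $\rhd_\varphi=\{((1,m),(2,\varphi(m)))\mid m\in x^q_B,\ \mathrm{pol}_{A\vdash B}(\partial_q(m))=+\}\cup\{((2,m),(1,\varphi^{ -1}(m)))\mid m\in x^p_B,\ \mathrm{pol}_{B\vdash C}(\partial_p(m))=+\}$. The interaction $p\circledast_\varphi q$ is $|q|+|p|$ ordered by the (reflexive) transitive closure of $\rhd$. -}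

module Defs where

open import Data.Nat using (ℕ)
open import Data.Fin using (Fin)
open import Data.Sum using (_⊎_; inj₁; inj₂)
open import Data.Product using (Σ; _×_; _,_; proj₁; proj₂)
open import Data.Empty using (⊥)
open import Data.Unit using (⊤; tt)
open import Data.List using (List)
open import Data.List.Membership.Propositional using (_∈_)
open import Relation.Nullary using (¬_)
open import Relation.Binary.PropositionalEquality using (_≡_)
open import Relation.Binary.Structures using (IsPartialOrder)
open import Function.Definitions using (Injective)
open import Function.Bundles using (_⇔_)

data Pol : Set where
  + − : Pol

flipPol : Pol → Pol
flipPol + = −
flipPol − = +

module _ {E : Set} (_≤_ : E → E → Set) where

  Lt : E → E → Set
  Lt e e' = (e ≤ e') × ¬ (e ≡ e')

  Cover : E → E → Set
  Cover e e' = Lt e e' × (∀ d → Lt e d → Lt d e' → ⊥)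

  Minimal : E → Set
  Minimal e = ∀ d → d ≤ e → d ≡ e

  Maximal : E → Set
  Maximal e = ∀ d → e ≤ d → d ≡ e

  record IsForest : Set where
    field
      isPartialOrder : IsPartialOrder _≡_ _≤_
      downFinite     : ∀ e → Σ (List E) (λ l → ∀ d → d ≤ e → d ∈ l)
      downTotal      : ∀ e d d' → d ≤ e → d' ≤ e → (d ≤ d') ⊎ (d' ≤ d)

record Game : Set₁ where
  field
    Ev  : Set
    _≤_ : Ev → Ev → Set
    pol : Ev → Pol

open Game public

record IsArena (A : Game) : Set where
  field
    countable : Σ (Ev A → ℕ) (λ f → Injective _≡_ _≡_ f)
    forest    : IsForest (_≤_ A)
    alternate : ∀ e e' → Cover (_≤_ A) e e' → pol A e' ≡ flipPol (pol A e)

IsNegative : Game → Set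
IsNegative A = ∀ e → Minimal (_≤_ A) e → pol A e ≡ −

sumOrd : {X Y : Set} → (X → X → Set) → (Y → Y → Set) → X ⊎ Y → X ⊎ Y → Set
sumOrd l r (inj₁ a) (inj₁ a') = l a a'
sumOrd l r (inj₁ a) (inj₂ b') = ⊥
sumOrd l r (inj₂ b) (inj₁ a') = ⊥
sumOrd l r (inj₂ b) (inj₂ b') = r b b'

sumPol : {X Y : Set} → (X → Pol) → (Y → Pol) → X ⊎ Y → Pol
sumPol f g (inj₁ a) = f a
sumPol f g (inj₂ b) = g b

_⊗_ : Game → Game → Game
A ⊗ B = record { Ev = Ev A ⊎ Ev B ; _≤_ = sumOrd (_≤_ A) (_≤_ B) ; pol = sumPol (pol A) (pol B) }

_^⊥ : Game → Game
A ^⊥ = record { Ev = Ev A ; _≤_ = _≤_ A ; pol = λ a → flipPol (pol A a) }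

_⊢_ : Game → Game → Game
A ⊢ B = (A ^⊥) ⊗ B

record IsConfiguration (A : Game) {n : ℕ} (_≤x_ : Fin n → Fin n → Set)
                       (∂ : Fin n → Ev A) : Set where
  field
    forest   : IsForest _≤x_
    minimal  : ∀ e → Minimal _≤x_ e ⇔ Minimal (_≤_ A) (∂ e)
    covers   : ∀ e e' → Cover _≤x_ e e' → Cover (_≤_ A) (∂ e) (∂ e')

record Augmentation (A : Game) : Set₁ where
  field
    size  : ℕ
    _≤⟨⟩_ : Fin size → Fin size → Set      -- ≤_⟨q⟩ (static order)
    _≤q_  : Fin size → Fin size → Set      -- ≤_q   (causal order)
    ∂     : Fin size → Ev A
    isConfiguration : IsConfiguration A _≤⟨⟩_ ∂
    forest   : IsForest _≤q_
    include  : ∀ e e' → e ≤⟨⟩ e' → e ≤q e'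
    coverStatic : ∀ e e' → Cover _≤q_ e e' →
                  (pol A (∂ e) ≡ + ⊎ pol A (∂ e') ≡ −) → Cover _≤⟨⟩_ e e'
    negSucc  : ∀ e e₁ e₂ → pol A (∂ e) ≡ − →
               Cover _≤q_ e e₁ → pol A (∂ e₁) ≡ + →
               Cover _≤q_ e e₂ → pol A (∂ e₂) ≡ + → e₁ ≡ e₂
    maxPos   : ∀ e → Maximal _≤q_ e → pol A (∂ e) ≡ +
    minNeg   : ∀ e → Minimal _≤q_ e → pol A (∂ e) ≡ −

open Augmentation public

IsInj₁ : {X Y : Set} → X ⊎ Y → Set
IsInj₁ (inj₁ _) = ⊤
IsInj₁ (inj₂ _) = ⊥

IsInj₂ : {X Y : Set} → X ⊎ Y → Set
IsInj₂ (inj₁ _) = ⊥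
IsInj₂ (inj₂ _) = ⊤

getInj₁ : {X Y : Set} → (z : X ⊎ Y) → IsInj₁ z → X
getInj₁ (inj₁ x) _ = x

getInj₂ : {X Y : Set} → (z : X ⊎ Y) → IsInj₂ z → Y
getInj₂ (inj₂ y) _ = y

module _ {A B C : Game} (q : Augmentation (A ⊢ B)) (p : Augmentation (B ⊢ C)) where

  XqB : Set
  XqB = Σ (Fin (size q)) (λ m → IsInj₂ (∂ q m))

  XpB : Set
  XpB = Σ (Fin (size p)) (λ m → IsInj₁ (∂ p m))

  dispq : XqB → Ev B
  dispq (m , h) = getInj₂ (∂ q m) h

  dispp : XpB → Ev B
  dispp (m , h) = getInj₁ (∂ p m) h

  record Symmetry : Set where
    field
      to       : XqB → XpB
      from     : XpB → XqB
      from∘to  : ∀ m → from (to m) ≡ m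
      to∘from  : ∀ m → to (from m) ≡ m
      monotone : ∀ m m' → (_≤⟨⟩_ q (proj₁ m) (proj₁ m')) ⇔
                          (_≤⟨⟩_ p (proj₁ (to m)) (proj₁ (to m')))
      display  : ∀ m → dispp (to m) ≡ dispq m

  open Symmetry public

  data Rhd (φ : Symmetry) : Fin (size q) ⊎ Fin (size p) → Fin (size q) ⊎ Fin (size p) → Set where
    stepq  : ∀ {m m'} → Lt (_≤q_ q) m m' → Rhd φ (inj₁ m) (inj₁ m')
    stepp  : ∀ {m m'} → Lt (_≤q_ p) m m' → Rhd φ (inj₂ m) (inj₂ m')
    stepφq : (m : XqB) → pol (A ⊢ B) (∂ q (proj₁ m)) ≡ + →
             Rhd φ (inj₁ (proj₁ m)) (inj₂ (proj₁ (to φ m)))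
    stepφp : (m : XpB) → pol (B ⊢ C) (∂ p (proj₁ m)) ≡ + →
             Rhd φ (inj₂ (proj₁ m)) (inj₁ (proj₁ (from φ m)))

-- Call an event settled when no ▷-cycle lies below it; it suffices that every event is settled.
-- The goal being a negation, the argument runs in the double-negation monad, where excluded
-- middle and hence extremal elements of finite forests are available.
--
-- Below an unsettled event there is a lowest one. Its predecessors inside its own augmentation
-- are settled, so it is entered by a φ-crossing from an unsettled event: it is a negative event
-- of x_B whose partner is unsettled too (a frontier). A negative frontier event of p is not
-- initial, B being negative, so its immediate causal predecessor is a positive static
-- predecessor t in x_B (its justifier). The partner of t is settled: its predecessors other
-- than t lie below partners of positive events statically below t, hence below the frontier.
-- The unsettled partner of the frontier has a frontier of its own, necessarily above the
-- partner of t, and its justifier t' gives partner(t) ▷⁺ partner(t'). Iterating produces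
-- ▷⁺-chains of settled events in the finite set |q| + |p|; such a chain revisits an event,
-- which then lies on a cycle below a settled event.

module Submission where

open import Defs
open import Data.Nat using (ℕ; zero; suc; s≤s; z≤n)
import Data.Nat as ℕ
open import Data.Nat.Properties using (n<1+n)
open import Data.Fin using (Fin; zero; suc; _↑ˡ_; _↑ʳ_; splitAt)
import Data.Fin as Fin
open import Data.Fin.Properties using (pigeonhole; ↑ˡ-injective; ↑ʳ-injective; splitAt-↑ˡ; splitAt-↑ʳ)
open import Data.Vec.Functional using () renaming (_∷_ to _∷ᵥ_)
open import Data.Sum using (_⊎_; inj₁; inj₂)
open import Data.Sum.Properties using (inj₁-injective; inj₂-injective)
open import Data.Product using (Σ; ∃₂; _×_; _,_; proj₁; proj₂)
open import Data.Empty using (⊥; ⊥-elim)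
open import Data.Unit using (tt)
open import Data.List using (List; []; _∷_)
open import Data.List.Membership.Propositional using (_∈_)
open import Data.List.Relation.Unary.Any using (here; there)
open import Effect.Monad using (RawMonad)
open import Level using (0ℓ)
open import Function.Base using (id; case_of_)
open import Function.Bundles using (Equivalence)
open import Function.Definitions using (Injective)
open import Relation.Nullary using (¬_; Dec; yes; no)
open import Relation.Nullary.Decidable using (¬¬-excluded-middle)
open import Relation.Nullary.Negation using (¬¬-Monad; ¬¬-map)
open import Relation.Binary.Definitions using (DecidableEquality)
open import Relation.Binary.PropositionalEquality using (_≡_; refl; sym; trans; subst; cong; module ≡-Reasoning)
import Relation.Binary.PropositionalEquality as ≡
open import Relation.Binary.Structures using (IsPartialOrder; IsStrictPartialOrder)
import Relation.Binary.Construct.NonStrictToStrict as Strict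
open import Relation.Binary.Construct.Closure.Transitive using (TransClosure; [_]; _∷_; _++_; _∷ʳ_)
open import Relation.Binary.Construct.Closure.ReflexiveTransitive using (Star; ε; _◅_; _◅◅_)

open RawMonad (¬¬-Monad {0ℓ}) using (_>>=_; pure)

¬¬_ : Set → Set
¬¬ A = ¬ ¬ A

module _ {E : Set} (_⊑_ : E → E → Set) (⊑-refl : ∀ {a} → a ⊑ a)
         (⊑-trans : ∀ {a b c} → a ⊑ b → b ⊑ c → a ⊑ c)
         {P : E → Set} (⊑-total : ∀ {a b} → P a → P b → a ⊑ b ⊎ b ⊑ a) where

  LeastIn : List E → E → Set
  LeastIn l m = P m × (∀ {d} → d ∈ l → P d → m ⊑ d)

  ¬¬-least : (l : List E) → Σ E P → ¬¬ Σ E (LeastIn l)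
  ¬¬-least []       (m , pm) = pure (m , pm , λ ())
  ¬¬-least (x ∷ xs) e        = do
    (m , least) ← ¬¬-least xs e
    P-x? ← ¬¬-excluded-middle
    pure (extend m least P-x?)
    where
    extend : ∀ m → LeastIn xs m → Dec (P x) → Σ E (LeastIn (x ∷ xs))
    extend m (pm , least) (no ¬px) =
      m , pm , λ { (here refl) px → ⊥-elim (¬px px) ; (there d∈xs) → least d∈xs }
    extend m (pm , least) (yes px) with ⊑-total pm px
    ... | inj₁ m⊑x = m , pm , λ { (here refl) _ → m⊑x ; (there d∈xs) → least d∈xs }
    ... | inj₂ x⊑m = x , px , λ { (here refl) _ → ⊑-refl
                                 ; (there d∈xs) pd → ⊑-trans x⊑m (least d∈xs pd) }

module ForestProperties {E : Set} {_≤_ : E → E → Set} (forest : IsForest _≤_) where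
  open IsForest forest
  open IsPartialOrder isPartialOrder using (antisym) renaming (refl to ≤-refl; trans to ≤-trans)

  private
    _<_ : E → E → Set
    _<_ = Lt _≤_

  ¬¬-minimal-below : ∀ {e} (Q : E → Set) → Q e →
                     ¬¬ Σ E λ m → m ≤ e × Q m × (∀ d → d < m → ¬ Q d)
  ¬¬-minimal-below {e} Q qe = do
    (m , (m≤e , qm) , least) ←
      ¬¬-least _≤_ ≤-refl ≤-trans {λ d → d ≤ e × Q d}
               (λ (a≤e , _) (b≤e , _) → downTotal e _ _ a≤e b≤e)
               (proj₁ (downFinite e)) (e , ≤-refl , qe)
    let minimal : ∀ d → d < m → ¬ Q d
        minimal _ (d≤m , d≢m) qd = d≢m (antisym d≤m
          (least (proj₂ (downFinite e) _ (≤-trans d≤m m≤e)) (≤-trans d≤m m≤e , qd)))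
    pure (m , m≤e , qm , minimal)

  ¬¬-immediate-predecessor : ∀ {d e} → d < e → ¬¬ Σ E λ u → Cover _≤_ u e
  ¬¬-immediate-predecessor {d} {e} d<e = do
    (u , u<e , greatest) ←
      ¬¬-least (λ a b → b ≤ a) ≤-refl (λ a≥b b≥c → ≤-trans b≥c a≥b) {_< e}
               (λ (a≤e , _) (b≤e , _) → downTotal e _ _ b≤e a≤e)
               (proj₁ (downFinite e)) (d , d<e)
    let immediate : ∀ x → u < x → x < e → ⊥
        immediate x (u≤x , u≢x) x<e =
          u≢x (antisym u≤x (greatest (proj₂ (downFinite e) x (proj₁ x<e)) x<e))
    pure (u , u<e , immediate)

  ≤-<-trans : ∀ {a b c} → a ≤ b → b < c → a < c
  ≤-<-trans = Strict.≤-<-trans _≡_ _≤_ ≤-trans antisym (λ { refl a≤b → a≤b })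

  cover-dominates : DecidableEquality E → ∀ {u e d} → Cover _≤_ u e → d < e → d ≤ u
  cover-dominates _≟_ {u} {e} {d} (u<e , immediate) (d≤e , d≢e) with downTotal e d u d≤e (proj₁ u<e)
  ... | inj₁ d≤u = d≤u
  ... | inj₂ u≤d with u ≟ d
  ...   | yes refl = ≤-refl
  ...   | no u≢d   = ⊥-elim (immediate d (u≤d , u≢d) (d≤e , d≢e))

¬minimal⇒¬¬below : {E : Set} {_≤_ : E → E → Set} → DecidableEquality E →
                   ∀ {e} → ¬ Minimal _≤_ e → ¬¬ Σ E λ d → Lt _≤_ d e
¬minimal⇒¬¬below _≟_ {e} ¬minimal below-none = ¬minimal λ d d≤e → case d ≟ e of λ
  { (yes d≡e) → d≡e
  ; (no d≢e)  → ⊥-elim (below-none (d , d≤e , d≢e)) }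

module Settledness {X : Set} (_▷_ : X → X → Set) where

  _▷⁺_ _▷*_ : X → X → Set
  _▷⁺_ = TransClosure _▷_
  _▷*_ = Star _▷_

  ▷*-▷⇒▷⁺ : ∀ {x y z} → x ▷* y → y ▷ z → x ▷⁺ z
  ▷*-▷⇒▷⁺ ε       y▷z = [ y▷z ]
  ▷*-▷⇒▷⁺ (r ◅ s) y▷z = r ∷ ▷*-▷⇒▷⁺ s y▷z

  ▷⁺-▷*⇒▷⁺ : ∀ {x y z} → x ▷⁺ y → y ▷* z → x ▷⁺ z
  ▷⁺-▷*⇒▷⁺ x▷⁺y ε       = x▷⁺y
  ▷⁺-▷*⇒▷⁺ x▷⁺y (r ◅ s) = ▷⁺-▷*⇒▷⁺ (x▷⁺y ∷ʳ r) s

  ▷⁺⇒▷*-▷ : ∀ {x z} → x ▷⁺ z → Σ X λ y → x ▷* y × y ▷ z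
  ▷⁺⇒▷*-▷ [ x▷z ]    = _ , ε , x▷z
  ▷⁺⇒▷*-▷ (r ∷ y▷⁺z) = let (y , s , y▷z) = ▷⁺⇒▷*-▷ y▷⁺z in y , r ◅ s , y▷z

  Settled : X → Set
  Settled x = ∀ {z} → z ▷* x → ¬ (z ▷⁺ z)

  settled-▷* : ∀ {x y} → y ▷* x → Settled x → Settled y
  settled-▷* y▷*x settled z▷*y = settled (z▷*y ◅◅ y▷*x)

  settled-stable : ∀ {x} → ¬¬ Settled x → Settled x
  settled-stable ¬¬settled z▷*x cycle = ¬¬settled λ settled → settled z▷*x cycle

  settled-from-predecessors : ∀ {x} → (∀ {y} → y ▷ x → Settled y) → Settled x
  settled-from-predecessors settled-predecessor {z} z▷*x cycle =
    let (y , z▷*y , y▷x) = ▷⁺⇒▷*-▷ (▷⁺-▷*⇒▷⁺ cycle z▷*x)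
    in  settled-predecessor y▷x z▷*y cycle

module _ {S X : Set} {_▷_ : X → X → Set} (event : S → X)
         (next : ∀ s → ¬¬ Σ S λ s' → TransClosure _▷_ (event s) (event s')) where

  Ascending : ∀ {n} → (Fin n → S) → Set
  Ascending g = ∀ a b → a Fin.< b → TransClosure _▷_ (event (g a)) (event (g b))

  ¬¬-walk : ∀ n s → ¬¬ Σ (Fin n → S) λ g → Ascending (s ∷ᵥ g)
  ¬¬-walk zero    s = pure ((λ ()) , λ { zero zero () })
  ¬¬-walk (suc n) s = do
    (s' , s▷⁺s') ← next s
    (g , ascending) ← ¬¬-walk n s'
    let extended : Ascending (s ∷ᵥ (s' ∷ᵥ g))
        extended = λ { zero (suc zero)    _         → s▷⁺s'
                     ; zero (suc (suc b)) _         → s▷⁺s' ++ ascending zero (suc b) (s≤s z≤n)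
                     ; (suc a) (suc b)    (s≤s a<b) → ascending a b a<b }
    pure (s' ∷ᵥ g , extended)

  ¬¬-revisit : ∀ {K} (index : X → Fin K) → Injective _≡_ _≡_ index →
               S → ¬¬ Σ S λ s → TransClosure _▷_ (event s) (event s)
  ¬¬-revisit {K} index index-injective s = do
    (g , ascending) ← ¬¬-walk K s
    let (a , b , a<b , same-index) = pigeonhole (n<1+n K) (λ c → index (event ((s ∷ᵥ g) c)))
    pure ((s ∷ᵥ g) a , subst (TransClosure _▷_ _) (sym (index-injective same-index)) (ascending a b a<b))

data Side : Set where
  left right : Side

data Opposite : Side → Side → Set where
  left-right : Opposite left right
  right-left : Opposite right left

opposite-sym : ∀ {i j} → Opposite i j → Opposite j i
opposite-sym left-right = right-left
opposite-sym right-left = left-right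

same-or-opposite : ∀ {i j} → Opposite i j → ∀ k → k ≡ i ⊎ Opposite k i
same-or-opposite left-right left  = inj₁ refl
same-or-opposite left-right right = inj₂ right-left
same-or-opposite right-left left  = inj₂ left-right
same-or-opposite right-left right = inj₁ refl

-- One of q, p seen through the events x_B it shares with the other: ≼ is its causal order ≤_q,
-- ⊑ its static order ≤_⟨q⟩.
record Half (Shared : Set) : Set₁ where
  field
    card                  : ℕ
    _≼_                   : Fin card → Fin card → Set
    _⊑_                   : Fin card → Fin card → Set
    ≼-forest              : IsForest _≼_
    ⊑⇒≼                   : ∀ {a b} → a ⊑ b → a ≼ b
    polarity              : Fin card → Pol
    negative-cover-static : ∀ {a b} → Cover _≼_ a b → polarity b ≡ − → Cover _⊑_ a b
    shared                : Shared → Fin card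
    shared-injective      : Injective _≡_ _≡_ shared
    static-cover-shared   : ∀ {a} w → Cover _⊑_ a (shared w) →
                            Σ Shared λ v → a ≡ shared v × polarity (shared v) ≡ flipPol (polarity (shared w))

  open ForestProperties ≼-forest

  Justifier : Shared → Fin card → Shared → Set
  Justifier w d t = Lt _⊑_ (shared t) (shared w) × polarity (shared t) ≡ + × d ≼ shared t

  ¬¬-justifier : ∀ {w d} → polarity (shared w) ≡ − → Lt _≼_ d (shared w) → ¬¬ Σ Shared (Justifier w d)
  ¬¬-justifier {w} {d} negative d≺w = ¬¬-map justifier (¬¬-immediate-predecessor d≺w)
    where
    justifier : Σ (Fin card) (λ u → Cover _≼_ u (shared w)) → Σ Shared (Justifier w d)
    justifier (u , u⋖w) with static-cover-shared w (negative-cover-static u⋖w negative)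
    ... | t , refl , polarity-t =
      t , proj₁ (negative-cover-static u⋖w negative) , trans polarity-t (cong flipPol negative) ,
      cover-dominates Fin._≟_ u⋖w d≺w

module Interaction {Shared : Set} (half : Side → Half Shared) where

  ∣_∣ : Side → ℕ
  ∣ i ∣ = Half.card (half i)

  Causal Strict-causal Static Strict-static : (i : Side) → Fin ∣ i ∣ → Fin ∣ i ∣ → Set
  Causal i        = Half._≼_ (half i)
  Strict-causal i = Lt (Causal i)
  Static i        = Half._⊑_ (half i)
  Strict-static i = Lt (Static i)

  syntax Causal i a b        = a ≼[ i ] b
  syntax Strict-causal i a b = a ≺[ i ] b
  syntax Static i a b        = a ⊑[ i ] b
  syntax Strict-static i a b = a ⊏[ i ] b

  polarity : (i : Side) → Fin ∣ i ∣ → Pol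
  polarity i = Half.polarity (half i)

  shared : (i : Side) → Shared → Fin ∣ i ∣
  shared i = Half.shared (half i)

  Event : Set
  Event = Σ Side λ i → Fin ∣ i ∣

  infix 4 _▷_

  data _▷_ : Event → Event → Set where
    internal : ∀ {i a b} → a ≺[ i ] b → (i , a) ▷ (i , b)
    cross    : ∀ {i j} → Opposite i j → ∀ w → polarity i (shared i w) ≡ + →
               (i , shared i w) ▷ (j , shared j w)

  open Settledness _▷_ public

  ▷-inversion : ∀ {i j y a} → Opposite j i → y ▷ (i , a) →
                Σ (Fin ∣ i ∣) (λ b → y ≡ (i , b) × b ≺[ i ] a) ⊎
                Σ Shared (λ w → a ≡ shared i w × y ≡ (j , shared j w) × polarity j (shared j w) ≡ +)
  ▷-inversion _          (internal b≺a)          = inj₁ (_ , refl , b≺a)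
  ▷-inversion left-right (cross left-right w pos) = inj₂ (w , refl , refl , pos)
  ▷-inversion right-left (cross right-left w pos) = inj₂ (w , refl , refl , pos)

  ≼⇒▷* : ∀ {i a b} → a ≼[ i ] b → (i , a) ▷* (i , b)
  ≼⇒▷* {a = a} {b} a≼b with a Fin.≟ b
  ... | yes refl = ε
  ... | no a≢b   = internal (a≼b , a≢b) ◅ ε

  index : Event → Fin (∣ left ∣ ℕ.+ ∣ right ∣)
  index (left  , a) = a ↑ˡ ∣ right ∣
  index (right , b) = ∣ left ∣ ↑ʳ b

  index-injective : Injective _≡_ _≡_ index
  index-injective {left  , a} {left  , b} eq = cong (left ,_)  (↑ˡ-injective _ a b eq)
  index-injective {right , a} {right , b} eq = cong (right ,_) (↑ʳ-injective _ a b eq)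
  index-injective {left  , a} {right , b} eq
    with () ← trans (sym (splitAt-↑ˡ _ a _)) (trans (cong (splitAt _) eq) (splitAt-↑ʳ _ _ b))
  index-injective {right , a} {left  , b} eq
    with () ← trans (sym (splitAt-↑ʳ _ _ a)) (trans (cong (splitAt _) eq) (splitAt-↑ˡ _ b _))

  module Acyclicity
    (shared-polarity : ∀ {i j} → Opposite i j → ∀ w →
                       polarity i (shared i w) ≡ flipPol (polarity j (shared j w)))
    (shared-static   : ∀ {i j} → Opposite i j → ∀ {v w} →
                       shared i v ⊑[ i ] shared i w → shared j v ⊑[ j ] shared j w)
    where

    record Frontier {i j} (o : Opposite i j) (w : Shared) : Set where
      field
        negative           : polarity i (shared i w) ≡ −
        unsettled          : ¬ Settled (i , shared i w)
        unsettled-opposite : ¬ Settled (j , shared j w)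
        settled-below      : ∀ {d} → d ≺[ i ] shared i w → Settled (i , d)

    ¬¬-frontier-at-lowest : ∀ {i j} (o : Opposite i j) {r} → ¬ Settled (i , r) →
                            (∀ {d} → d ≺[ i ] r → Settled (i , d)) →
                            ¬¬ Σ Shared λ w → r ≡ shared i w × Frontier o w
    ¬¬-frontier-at-lowest {i} o {r} unsettled-r settled-below no-frontier =
      unsettled-r (settled-from-predecessors settled-predecessor)
      where
      settled-predecessor : ∀ {y} → y ▷ (i , r) → Settled y
      settled-predecessor y▷r with ▷-inversion (opposite-sym o) y▷r
      ... | inj₁ (d , refl , d≺r)           = settled-below d≺r
      ... | inj₂ (w , refl , refl , positive) = settled-stable λ unsettled-opposite →
        no-frontier (w , refl , record
          { negative           = trans (shared-polarity o w) (cong flipPol positive)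
          ; unsettled          = unsettled-r
          ; unsettled-opposite = unsettled-opposite
          ; settled-below      = settled-below })

    ¬¬-frontier-below : ∀ {i j} (o : Opposite i j) {m} → ¬ Settled (i , m) →
                        ¬¬ Σ Shared λ w → shared i w ≼[ i ] m × Frontier o w
    ¬¬-frontier-below {i} o {m} unsettled-m = do
      (r , r≼m , unsettled-r , minimal) ←
        ForestProperties.¬¬-minimal-below (Half.≼-forest (half i)) (λ d → ¬ Settled (i , d)) unsettled-m
      (w , r≡w , frontier) ←
        ¬¬-frontier-at-lowest o unsettled-r λ d≺r → settled-stable (minimal _ d≺r)
      pure (w , subst (λ a → a ≼[ i ] m) r≡w r≼m , frontier)

    record State {i j} (o : Opposite i j) : Set where
      field
        target             : Shared
        justifier          : Shared
        frontier           : Frontier o target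
        justifies          : shared i justifier ⊏[ i ] shared i target
        justifier-positive : polarity i (shared i justifier) ≡ +

    event : ∀ {i j} {o : Opposite i j} → State o → Event
    event {j = j} s = j , shared j (State.justifier s)

    ¬¬-state : ∀ {i j} {o : Opposite i j} {w d} → Frontier o w → d ≺[ i ] shared i w →
               ¬¬ Σ (State o) λ s → d ≼[ i ] shared i (State.justifier s)
    ¬¬-state {i} {o = o} {w} {d} frontier d≺w = ¬¬-map state
      (Half.¬¬-justifier (half i) (Frontier.negative frontier) d≺w)
      where
      state : Σ Shared (Half.Justifier (half i) w d) → Σ (State o) λ s → d ≼[ i ] shared i (State.justifier s)
      state (t , t⊏w , positive , d≼t) = record
        { target = w ; justifier = t ; frontier = frontier ; justifies = t⊏w ; justifier-positive = positive }
        , d≼t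

    settled-event : ∀ {i j} {o : Opposite i j} (s : State o) → Settled (event s)
    settled-event {i} {j} {o} s = settled-from-predecessors settled-predecessor
      where
      open State s
      open Frontier frontier
      t = justifier

      t-negative-opposite : polarity j (shared j t) ≡ −
      t-negative-opposite = trans (shared-polarity (opposite-sym o) t) (cong flipPol justifier-positive)

      t≺w : shared i t ≺[ i ] shared i target
      t≺w = Half.⊑⇒≼ (half i) (proj₁ justifies) , proj₂ justifies

      settled-below-justifier : ∀ {v} → shared j v ⊑[ j ] shared j t → Settled (i , shared i v)
      settled-below-justifier v⊑t = settled-below
        (ForestProperties.≤-<-trans (Half.≼-forest (half i))
          (Half.⊑⇒≼ (half i) (shared-static (opposite-sym o) v⊑t)) t≺w)

      settled-predecessor : ∀ {y} → y ▷ event s → Settled y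
      settled-predecessor y▷t with ▷-inversion o y▷t
      ... | inj₁ (d , refl , d≺t) =
        settled-stable (¬¬-map settled-via (Half.¬¬-justifier (half j) t-negative-opposite d≺t))
        where
        settled-via : Σ Shared (Half.Justifier (half j) t d) → Settled (j , d)
        settled-via (v , v⊏t , positive , d≼v) =
          settled-▷* (≼⇒▷* d≼v)
            (settled-▷* (cross (opposite-sym o) v positive ◅ ε) (settled-below-justifier (proj₁ v⊏t)))
      ... | inj₂ (v , t≡v , refl , _) with Half.shared-injective (half j) t≡v
      ...   | refl = settled-below t≺w

    ¬¬-next : ∀ {i j} {o : Opposite i j} (s : State o) →
              ¬¬ Σ (State (opposite-sym o)) λ s' → event s ▷⁺ event s'
    ¬¬-next {i} {j} {o} s = do
      (v , v≼w , frontier') ← ¬¬-frontier-below (opposite-sym o) unsettled-opposite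
      continue frontier' (IsForest.downTotal (Half.≼-forest (half j)) _ _ _ t≼w v≼w)
      where
      open State s
      open Frontier frontier
      t = justifier

      t≼w : shared j t ≼[ j ] shared j target
      t≼w = Half.⊑⇒≼ (half j) (shared-static o (proj₁ justifies))

      link : (Σ (State (opposite-sym o)) λ s' → shared j t ≼[ j ] shared j (State.justifier s')) →
             Σ (State (opposite-sym o)) λ s' → event s ▷⁺ event s'
      link (s' , t≼t') = s' , ▷*-▷⇒▷⁺ (≼⇒▷* t≼t')
        (cross (opposite-sym o) (State.justifier s') (State.justifier-positive s'))

      continue : ∀ {v} → Frontier (opposite-sym o) v →
                 shared j t ≼[ j ] shared j v ⊎ shared j v ≼[ j ] shared j t →
                 ¬¬ Σ (State (opposite-sym o)) λ s' → event s ▷⁺ event s'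
      continue frontier' (inj₁ t≼v) = ¬¬-map link (¬¬-state frontier' (t≼v , λ t≡v →
        Frontier.unsettled frontier' (subst (λ a → Settled (j , a)) t≡v (settled-event s))))
      continue frontier' (inj₂ v≼t) =
        ⊥-elim (Frontier.unsettled frontier' (settled-▷* (≼⇒▷* v≼t) (settled-event s)))

    ¬¬-frontier : ∀ {i j} (o : Opposite i j) {x} → ¬ Settled x → ¬¬ Σ Shared (Frontier o)
    ¬¬-frontier o {k , m} unsettled with same-or-opposite o k
    ... | inj₁ refl = ¬¬-map (λ (w , _ , frontier) → w , frontier) (¬¬-frontier-below o unsettled)
    ... | inj₂ o'   = do
      (w , _ , frontier) ← ¬¬-frontier-below o' unsettled
      (v , _ , frontier') ← ¬¬-frontier-below o (Frontier.unsettled-opposite frontier)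
      pure (v , frontier')

    AnyState : Set
    AnyState = ∃₂ λ i j → Σ (Opposite i j) State

    any-event : AnyState → Event
    any-event (_ , _ , _ , s) = event s

    ¬¬-any-next : ∀ s → ¬¬ Σ AnyState λ s' → any-event s ▷⁺ any-event s'
    ¬¬-any-next (_ , _ , _ , s) = ¬¬-map (λ (s' , s▷⁺s') → (_ , _ , _ , s') , s▷⁺s') (¬¬-next s)

    ▷⁺-irreflexive : ∀ {i j} → Opposite i j →
                     (∀ w → polarity i (shared i w) ≡ − → ¬ Minimal (Static i) (shared i w)) →
                     ∀ {x} → ¬ (x ▷⁺ x)
    ▷⁺-irreflexive {i} o static-nonminimal {x} x▷⁺x =
      ¬¬-revisited-state λ ((_ , _ , _ , s) , s▷⁺s) → settled-event s ε s▷⁺s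
      where
      ¬¬-revisited-state : ¬¬ Σ AnyState λ s → any-event s ▷⁺ any-event s
      ¬¬-revisited-state = do
        (w , frontier) ← ¬¬-frontier o λ settled → settled ε x▷⁺x
        (d , d⊏w) ← ¬minimal⇒¬¬below {_≤_ = Static i} Fin._≟_
                      (static-nonminimal w (Frontier.negative frontier))
        (s , _) ← ¬¬-state frontier (Half.⊑⇒≼ (half i) (proj₁ d⊏w) , proj₂ d⊏w)
        ¬¬-revisit any-event ¬¬-any-next index index-injective (_ , _ , o , s)

flipPol-involutive : ∀ x → flipPol (flipPol x) ≡ x
flipPol-involutive + = refl
flipPol-involutive − = refl

Alternating : Game → Set
Alternating G = ∀ {a b} → Cover (_≤_ G) a b → pol G a ≡ flipPol (pol G b)

arena-alternating : ∀ {G} → IsArena G → Alternating G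
arena-alternating {G} arena {a} {b} a⋖b = begin
  pol G a                     ≡⟨ flipPol-involutive (pol G a) ⟨
  flipPol (flipPol (pol G a)) ≡⟨ cong flipPol (IsArena.alternate arena a b a⋖b) ⟨
  flipPol (pol G b)           ∎
  where open ≡-Reasoning

^⊥-alternating : ∀ {G} → Alternating G → Alternating (G ^⊥)
^⊥-alternating alternating a⋖b = cong flipPol (alternating a⋖b)

cover-reflect : {X Y : Set} {_≤X_ : X → X → Set} {_≤Y_ : Y → Y → Set} (f : X → Y) →
                Injective _≡_ _≡_ f →
                (∀ {a b} → f a ≤Y f b → a ≤X b) → (∀ {a b} → a ≤X b → f a ≤Y f b) →
                ∀ {a b} → Cover _≤Y_ (f a) (f b) → Cover _≤X_ a b
cover-reflect f f-injective reflect preserve ((fa≤fb , fa≢fb) , immediate) =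
  (reflect fa≤fb , λ a≡b → fa≢fb (cong f a≡b)) ,
  λ d (a≤d , a≢d) (d≤b , d≢b) → immediate (f d)
    (preserve a≤d , λ fa≡fd → a≢d (f-injective fa≡fd))
    (preserve d≤b , λ fd≡fb → d≢b (f-injective fd≡fb))

module _ {G H : Game} where

  ⊗-cover-inj₁ : Alternating G → ∀ {z z'} → IsInj₁ z' → Cover (_≤_ (G ⊗ H)) z z' →
                 IsInj₁ z × pol (G ⊗ H) z ≡ flipPol (pol (G ⊗ H) z')
  ⊗-cover-inj₁ alternating {inj₁ _} {inj₁ _} _ z⋖z' =
    tt , alternating (cover-reflect {_≤Y_ = _≤_ (G ⊗ H)} inj₁ inj₁-injective id id z⋖z')
  ⊗-cover-inj₁ alternating {inj₂ _} {inj₁ _} _ ((() , _) , _)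

  ⊗-cover-inj₂ : Alternating H → ∀ {z z'} → IsInj₂ z' → Cover (_≤_ (G ⊗ H)) z z' →
                 IsInj₂ z × pol (G ⊗ H) z ≡ flipPol (pol (G ⊗ H) z')
  ⊗-cover-inj₂ alternating {inj₂ _} {inj₂ _} _ z⋖z' =
    tt , alternating (cover-reflect {_≤Y_ = _≤_ (G ⊗ H)} inj₂ inj₂-injective id id z⋖z')
  ⊗-cover-inj₂ alternating {inj₁ _} {inj₂ _} _ ((() , _) , _)

  ⊢-minimal-inj₁ : IsNegative G → ∀ {z} → IsInj₁ z → Minimal (_≤_ (G ⊢ H)) z → pol (G ⊢ H) z ≡ +
  ⊢-minimal-inj₁ negative {inj₁ a} _ minimal =
    cong flipPol (negative a λ d d≤a → inj₁-injective (minimal (inj₁ d) d≤a))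

IsInj₁-irrelevant : {X Y : Set} (z : X ⊎ Y) (h h' : IsInj₁ z) → h ≡ h'
IsInj₁-irrelevant (inj₁ _) tt tt = refl

IsInj₂-irrelevant : {X Y : Set} (z : X ⊎ Y) (h h' : IsInj₂ z) → h ≡ h'
IsInj₂-irrelevant (inj₂ _) tt tt = refl

StaticCoversShared : {G : Game} (r : Augmentation G) {Shared : Set} → (Shared → Fin (size r)) → Set
StaticCoversShared {G} r {Shared} shared = ∀ {a} w → Cover (_≤⟨⟩_ r) a (shared w) →
  Σ Shared λ v → a ≡ shared v × pol G (∂ r (shared v)) ≡ flipPol (pol G (∂ r (shared w)))

augmentation-half : {G : Game} (r : Augmentation G) {Shared : Set} (shared : Shared → Fin (size r)) →
                    Injective _≡_ _≡_ shared → StaticCoversShared r shared → Half Shared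
augmentation-half {G} r shared shared-injective static-cover-shared = record
  { card                  = size r
  ; _≼_                   = _≤q_ r
  ; _⊑_                   = _≤⟨⟩_ r
  ; ≼-forest              = forest r
  ; ⊑⇒≼                   = include r _ _
  ; polarity              = λ a → pol G (∂ r a)
  ; negative-cover-static = λ a⋖b negative → coverStatic r _ _ a⋖b (inj₂ negative)
  ; shared                = shared
  ; shared-injective      = shared-injective
  ; static-cover-shared   = static-cover-shared
  }

module Composition {A B C : Game} (B-arena : IsArena B) (B-negative : IsNegative B)
                   (q : Augmentation (A ⊢ B)) (p : Augmentation (B ⊢ C)) (φ : Symmetry q p) where

  shared-q : XqB q p → Fin (size q)
  shared-q = proj₁

  shared-p : XqB q p → Fin (size p)
  shared-p w = proj₁ (to φ w)

  shared-q-injective : Injective _≡_ _≡_ shared-q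
  shared-q-injective {m , h} {.m , h'} refl = cong (m ,_) (IsInj₂-irrelevant (∂ q m) h h')

  shared-p-injective : Injective _≡_ _≡_ shared-p
  shared-p-injective {v} {w} eq = begin
    v                   ≡⟨ from∘to φ v ⟨
    from φ (to φ v)     ≡⟨ cong (from φ) (proj₁-injective eq) ⟩
    from φ (to φ w)     ≡⟨ from∘to φ w ⟩
    w                   ∎
    where
    open ≡-Reasoning
    proj₁-injective : ∀ {x y : XpB q p} → proj₁ x ≡ proj₁ y → x ≡ y
    proj₁-injective {m , h} {.m , h'} refl = cong (m ,_) (IsInj₁-irrelevant (∂ p m) h h')

  static-cover-q : StaticCoversShared q shared-q
  static-cover-q {a} w a⋖w
    with ⊗-cover-inj₂ (arena-alternating B-arena) (proj₂ w)
           (IsConfiguration.covers (isConfiguration q) a (shared-q w) a⋖w)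
  ... | h , flipped = (a , h) , refl , flipped

  static-cover-p : StaticCoversShared p shared-p
  static-cover-p {a} w a⋖w
    with ⊗-cover-inj₁ (^⊥-alternating (arena-alternating B-arena)) (proj₂ (to φ w))
           (IsConfiguration.covers (isConfiguration p) a (shared-p w) a⋖w)
  ... | h , flipped = from φ (a , h) , cong proj₁ (sym (to∘from φ (a , h))) ,
    subst (λ x → pol (B ⊢ C) (∂ p (proj₁ x)) ≡ flipPol (pol (B ⊢ C) (∂ p (shared-p w))))
          (sym (to∘from φ (a , h))) flipped

  half : Side → Half (XqB q p)
  half left  = augmentation-half q shared-q shared-q-injective static-cover-q
  half right = augmentation-half p shared-p shared-p-injective static-cover-p

  open Interaction half

  polarity-q : ∀ w → pol (A ⊢ B) (∂ q (shared-q w)) ≡ pol B (dispq q p w)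
  polarity-q (m , h) with ∂ q m
  ... | inj₂ _ = refl

  polarity-p : ∀ w → pol (B ⊢ C) (∂ p (shared-p w)) ≡ flipPol (pol B (dispq q p w))
  polarity-p w = trans (polarity-inj₁ (to φ w)) (cong (λ b → flipPol (pol B b)) (display φ w))
    where
    polarity-inj₁ : ∀ x → pol (B ⊢ C) (∂ p (proj₁ x)) ≡ flipPol (pol B (dispp q p x))
    polarity-inj₁ (m , h) with ∂ p m
    ... | inj₁ _ = refl

  shared-polarity : ∀ {i j} → Opposite i j → ∀ w → polarity i (shared i w) ≡ flipPol (polarity j (shared j w))
  shared-polarity left-right w = begin
    pol (A ⊢ B) (∂ q (shared-q w))          ≡⟨ polarity-q w ⟩
    pol B (dispq q p w)                     ≡⟨ flipPol-involutive _ ⟨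
    flipPol (flipPol (pol B (dispq q p w))) ≡⟨ cong flipPol (polarity-p w) ⟨
    flipPol (pol (B ⊢ C) (∂ p (shared-p w))) ∎
    where open ≡-Reasoning
  shared-polarity right-left w = trans (polarity-p w) (cong flipPol (sym (polarity-q w)))

  shared-static : ∀ {i j} → Opposite i j → ∀ {v w} →
                  shared i v ⊑[ i ] shared i w → shared j v ⊑[ j ] shared j w
  shared-static left-right = Equivalence.to (monotone φ _ _)
  shared-static right-left = Equivalence.from (monotone φ _ _)

  negative-p-nonminimal : ∀ w → polarity right (shared right w) ≡ − → ¬ Minimal (Static right) (shared right w)
  negative-p-nonminimal w negative minimal = +≢− (trans (sym positive) negative)
    where
    +≢− : + ≡ − → ⊥
    +≢− ()
    positive : pol (B ⊢ C) (∂ p (shared-p w)) ≡ +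
    positive = ⊢-minimal-inj₁ B-negative (proj₂ (to φ w))
      (Equivalence.to (IsConfiguration.minimal (isConfiguration p) (shared-p w)) minimal)

  embed : Fin (size q) ⊎ Fin (size p) → Event
  embed (inj₁ m) = left , m
  embed (inj₂ m) = right , m

  Rhd⇒▷ : ∀ {x y} → Rhd q p φ x y → embed x ▷ embed y
  Rhd⇒▷ (stepq m<m')        = internal m<m'
  Rhd⇒▷ (stepp m<m')        = internal m<m'
  Rhd⇒▷ (stepφq w positive) = cross left-right w positive
  Rhd⇒▷ (stepφp m positive) = cross-back (from φ m) (to∘from φ m) positive
    where
    cross-back : ∀ {m} w → to φ w ≡ m → pol (B ⊢ C) (∂ p (proj₁ m)) ≡ + →
                 (right , proj₁ m) ▷ (left , shared-q w)
    cross-back w refl positive = cross right-left w positive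

  Rhd⁺⇒▷⁺ : ∀ {x y} → TransClosure (Rhd q p φ) x y → embed x ▷⁺ embed y
  Rhd⁺⇒▷⁺ [ r ]     = [ Rhd⇒▷ r ]
  Rhd⁺⇒▷⁺ (r ∷ rs) = Rhd⇒▷ r ∷ Rhd⁺⇒▷⁺ rs

  Rhd⁺-irreflexive : ∀ {x} → ¬ TransClosure (Rhd q p φ) x x
  Rhd⁺-irreflexive cycle =
    Acyclicity.▷⁺-irreflexive shared-polarity shared-static right-left negative-p-nonminimal (Rhd⁺⇒▷⁺ cycle)

proposition5p2 : (A B C : Game) → IsArena A → IsArena B → IsArena C →
    IsNegative A → IsNegative B → IsNegative C →
    (q : Augmentation (A ⊢ B)) (p : Augmentation (B ⊢ C)) (φ : Symmetry q p) →
    IsStrictPartialOrder _≡_ (TransClosure (Rhd q p φ))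
proposition5p2 A B C _ B-arena _ _ B-negative _ q p φ = record
  { isEquivalence = ≡.isEquivalence
  ; irrefl        = λ { refl → Composition.Rhd⁺-irreflexive B-arena B-negative q p φ }
  ; trans         = _++_
  ; <-resp-≈      = ≡.resp₂ _
  }
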